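{- For timed MSR systems (with properties taken with respect to an initial configuration $\mathcal{S}_0$, a critical configuration specification $\mathcal{CS}$ and lazy time sampling): a timed MSR system satisfying the $S$ property need not satisfy the $L$ property, and a timed MSR system satisfying the $L$ property need not satisfy the $S$ property. That is, there exist a timed MSR system with $\mathcal{S}_0,\mathcal{CS}$ satisfying $S$ but not $L$, and there exist a timed MSR system with $\mathcal{S}_0,\mathcal{CS}$ satisfying $L$ but not $S$.
   Context: A fact is $P(u_1,\dots,u_n)$ over a finite first-order typed alphabet; a timestamped fact is $F@t$, $t\in\mathbb{N}$. A configuration is a finite multiset of ground timestamped facts with exactly one fact $Time@t$ (global time $t$). The $Tick$ rule is $Time@T\to Time@(T+1)$. An instantaneous rule has the form $Time@T, W_1@T_1,\dots,W_p@T_p, F_1@T_1',\dots,F_n@T_n' \mid \mathcal{C} \to \exists \vec X.[Time@T, W_1@T_1,\dots,W_p@T_p, Q_1@(T+d_1),\dots,Q_m@(T+d_m)]$ with $d_i\in\mathbb{N}$, $\mathcal{C}$ a set of constraints $T_a>T_b\pm d$ or $T_a=T_b\pm d$ over the precondition's time variables, $\vec X$ fresh values. A rule $\mathcal{W}\mid\mathcal{C}\to\exists\vec X.\mathcal{W}'$ applies to $\mathcal{S}$ if for a ground substitution $\sigma$, $\mathcal{W}\sigma\subseteq\mathcal{S}$ and $\mathcal{C}\sigma$ holds, giving $((\mathcal{S}\setminus\mathcal{W})\cup\mathcal{W}')\sigma$. A timed MSR system is a set of instantaneous rules plus $Tick$. A trace is a finite or infinite sequence of single rule applications; an infinite time trace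 is one in which the global time exceeds every $n\in\mathbb{N}$. A critical configuration specification is a set of pairs $\langle\mathcal{S}_j,\mathcal{C}_j\rangle$, $\mathcal{S}_j$ a finite multiset of facts $F@T$ with time variables, $\mathcal{C}_j$ constraints on them; $\mathcal{S}$ is critical if some $\mathcal{S}_j\sigma\subseteq\mathcal{S}$ with $\mathcal{C}_j\sigma$ true for a ground substitution $\sigma$ (nonces renamed). A trace is compliant if it contains no critical configuration. A trace uses lazy time sampling (l.t.s.) if whenever $\mathcal{S}_i\to_{Tick}\mathcal{S}_{i+1}$ occurs, no instantaneous rule instance is applicable to $\mathcal{S}_i$. $Z$ property: there is a compliant infinite time trace from $\mathcal{S}_0$ using l.t.s. $S$ property: $Z$ holds and every infinite time trace from $\mathcal{S}_0$ using l.t.s. is compliant. $L$ property: $Z$ holds and for every configuration $\mathcal{S}$ reachable from $\mathcal{S}_0$ by a compliant trace using l.t.s., there is a compliant infinite time trace from $\mathcal{S}$ using l.t.s. -}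

module Defs where

open import Data.Nat using (ℕ; _+_; _<_; suc)
open import Data.List using (List; []; _∷_; _++_; map; concatMap)
open import Data.List.Membership.Propositional using (_∈_; _∉_)
open import Data.List.Relation.Unary.All using (All)
open import Data.List.Relation.Unary.Any using (Any)
open import Data.List.Relation.Unary.Unique.Propositional using (Unique)
open import Data.List.Relation.Binary.Permutation.Propositional using (_↭_)
open import Data.Product using (Σ; ∃; _×_; _,_)
open import Data.Sum using (_⊎_)
open import Relation.Nullary using (¬_)
open import Relation.Binary.PropositionalEquality using (_≡_)

-- Predicate symbols are natural numbers; the
-- distinguished fact Time@t is not a predicate of this kind: it is
-- represented by the field 'now' of a configuration (so every
-- configuration has exactly one Time fact by construction).

data Val : Set where
  cst   : ℕ → Val
  nonce : ℕ → Val

data IsNonce : Val → Set where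
  isNonce : ∀ n → IsNonce (nonce n)

data Term : Set where
  var : ℕ → Term
  con : ℕ → Term

record GFact : Set where
  constructor gfact
  field
    pred : ℕ
    args : List Val
    time : ℕ
open GFact public

record PFact : Set where
  constructor pfact
  field
    ppred : ℕ
    pargs : List Term
    ptvar : ℕ
open PFact public

record QFact : Set where
  constructor qfact
  field
    qpred  : ℕ
    qargs  : List Term
    qdelay : ℕ
open QFact public

-- configuration: global time (the unique Time@t fact) and a finite
-- multiset (list up to permutation) of the other ground facts
record Config : Set where
  constructor config
  field
    now   : ℕ
    facts : List GFact
open Config public

-- Time constraints  T_a > T_b ± d,  T_a = T_b ± d  (over the integers;
-- written here equivalently without subtraction)

data Constraint : Set where
  gtPlus  : ℕ → ℕ → ℕ → Constraint   -- T_a > T_b + d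
  gtMinus : ℕ → ℕ → ℕ → Constraint   -- T_a > T_b - d
  eqPlus  : ℕ → ℕ → ℕ → Constraint   -- T_a = T_b + d
  eqMinus : ℕ → ℕ → ℕ → Constraint   -- T_a = T_b - d

Holds : (ℕ → ℕ) → Constraint → Set
Holds τ (gtPlus  a b d) = τ b + d < τ a
Holds τ (gtMinus a b d) = τ b < τ a + d
Holds τ (eqPlus  a b d) = τ a ≡ τ b + d
Holds τ (eqMinus a b d) = τ a + d ≡ τ b

cvars : Constraint → List ℕ
cvars (gtPlus  a b _) = a ∷ b ∷ []
cvars (gtMinus a b _) = a ∷ b ∷ []
cvars (eqPlus  a b _) = a ∷ b ∷ []
cvars (eqMinus a b _) = a ∷ b ∷ []

inst : (ℕ → Val) → Term → Val
inst σ (var x) = σ x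
inst σ (con c) = cst c

instP : (ℕ → Val) → (ℕ → ℕ) → PFact → GFact
instP σ τ f = gfact (ppred f) (map (inst σ) (pargs f)) (τ (ptvar f))

instQ : (ℕ → Val) → ℕ → QFact → GFact
instQ σ t q = gfact (qpred q) (map (inst σ) (qargs q)) (t + qdelay q)

termVars : List Term → List ℕ
termVars [] = []
termVars (var x ∷ ts) = x ∷ termVars ts
termVars (con _ ∷ ts) = termVars ts

valuesOf : List GFact → List Val
valuesOf = concatMap args

-- Instantaneous rules
--   Time@T, W_1@T_1..W_p@T_p, F_1@T'_1..F_n@T'_n | C
--     → ∃X. Time@T, W_1@T_1..W_p@T_p, Q_1@(T+d_1)..Q_m@(T+d_m)

record Rule : Set where
  constructor rule
  field
    rtvar       : ℕ
    kept        : List PFact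
    consumed    : List PFact
    constraints : List Constraint
    freshVars   : List ℕ
    produced    : List QFact
open Rule public

preTimeVars : Rule → List ℕ
preTimeVars r = rtvar r ∷ map ptvar (kept r ++ consumed r)

preTermVars : Rule → List ℕ
preTermVars r = concatMap (λ f → termVars (pargs f)) (kept r ++ consumed r)

WFRule : Rule → Set
WFRule r =
  All (λ c → All (λ v → v ∈ preTimeVars r) (cvars c)) (constraints r)
  × All (λ x → x ∉ preTermVars r) (freshVars r)
  × Unique (freshVars r)
  × All (λ q → All (λ x → x ∈ preTermVars r ⊎ x ∈ freshVars r) (termVars (qargs q)))
        (produced r)

InstStep : Rule → Config → Config → Set
InstStep r S S′ =
  Σ (ℕ → Val) λ σ → Σ (ℕ → ℕ) λ τ → Σ (List GFact) λ rest →
    τ (rtvar r) ≡ now S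
    × All (Holds τ) (constraints r)
    × All (λ x → IsNonce (σ x) × σ x ∉ valuesOf (facts S)) (freshVars r)
    × Unique (map σ (freshVars r))
    × facts S ↭ (map (instP σ τ) (kept r ++ consumed r) ++ rest)
    × now S′ ≡ now S
    × facts S′ ↭ (map (instP σ τ) (kept r) ++ map (instQ σ (now S)) (produced r) ++ rest)

System : Set
System = List Rule

WFSystem : System → Set
WFSystem = All WFRule

Applicable : System → Config → Set
Applicable R S = Any (λ r → ∃ λ S′ → InstStep r S S′) R

Tick : Config → Config → Set
Tick S S′ = now S′ ≡ suc (now S) × facts S′ ≡ facts S

LStep : System → Config → Config → Set
LStep R S S′ = Any (λ r → InstStep r S S′) R ⊎ (Tick S S′ × ¬ Applicable R S)

-- ⟨S_j, C_j⟩ ; the pattern always also contains Time@T with T = ctvar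
-- (harmless since every configuration has exactly one Time fact)
record CritPat : Set where
  constructor critPat
  field
    ctvar  : ℕ
    cfacts : List PFact
    ccons  : List Constraint
open CritPat public

CritSpec : Set
CritSpec = List CritPat

WFCritPat : CritPat → Set
WFCritPat p = All (λ c → All (λ v → v ∈ (ctvar p ∷ map ptvar (cfacts p))) (cvars c)) (ccons p)

Critical : CritSpec → Config → Set
Critical CS S = Any (λ p →
  Σ (ℕ → Val) λ σ → Σ (ℕ → ℕ) λ τ → Σ (List GFact) λ rest →
    τ (ctvar p) ≡ now S
    × All (Holds τ) (ccons p)
    × facts S ↭ (map (instP σ τ) (cfacts p) ++ rest)) CS

Trace : Set
Trace = ℕ → Config

InfTimeLTS : System → Config → Trace → Set
InfTimeLTS R S0 tr =
  tr 0 ≡ S0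
  × (∀ i → LStep R (tr i) (tr (suc i)))
  × (∀ n → ∃ λ i → n < now (tr i))

Compliant : CritSpec → Trace → Set
Compliant CS tr = ∀ i → ¬ Critical CS (tr i)

data CReach (R : System) (CS : CritSpec) (S0 : Config) : Config → Set where
  start : ¬ Critical CS S0 → CReach R CS S0 S0
  step  : ∀ {S S′} → CReach R CS S0 S → LStep R S S′ → ¬ Critical CS S′ →
          CReach R CS S0 S′

ZProp : System → Config → CritSpec → Set
ZProp R S0 CS = ∃ λ tr → InfTimeLTS R S0 tr × Compliant CS tr

SProp : System → Config → CritSpec → Set
SProp R S0 CS = ZProp R S0 CS × (∀ tr → InfTimeLTS R S0 tr → Compliant CS tr)

LProp : System → Config → CritSpec → Set
LProp R S0 CS = ZProp R S0 CS × (∀ S → CReach R CS S0 S → ZProp R S CS)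

WFInstance : System → CritSpec → Set
WFInstance R CS = WFSystem R × All WFCritPat CS

-- Both counterexamples use nullary facts A and B and start from A@0.
--
-- S without L: with the rules A → B, A → ∅ and B → B (keeping B), and no
-- critical configurations, every trace is compliant, and discarding A and
-- then ticking forever is an infinite time trace.  But once A has become B
-- the rule B → B is always applicable, so lazy time sampling forbids Tick
-- and time is frozen: no infinite time trace exists from there.
--
-- L without S: with the rules A → B and A → ∅ and B critical, a compliant
-- trace never fires A → B, so every compliant reachable configuration
-- consists of A facts only, from which discarding and ticking is a
-- compliant infinite time trace.  Yet firing A → B and then ticking forever
-- is an infinite time trace, and it is not compliant.
module Submission where

open import Defs
open import Data.Empty using (⊥-elim)
open import Data.List using (List; []; _∷_; _++_; map)
open import Data.List.Membership.Propositional using (_∈_; lose)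
open import Data.List.Membership.Propositional.Properties
  using (∈-map⁺; ∈-map⁻; ∈-++⁺ˡ; ∈-++⁺ʳ; ∈-++⁻; ∈-∃++)
open import Data.List.Relation.Binary.Permutation.Propositional using (_↭_; ↭-sym; ↭-refl)
open import Data.List.Relation.Binary.Permutation.Propositional.Properties
  using (∈-resp-↭; All-resp-↭; shift)
open import Data.List.Relation.Unary.All as All using (All; []; _∷_)
open import Data.List.Relation.Unary.All.Properties using (All¬⇒¬Any)
open import Data.List.Relation.Unary.Any using (here; there)
import Data.List.Relation.Unary.AllPairs as AllPairs
open import Data.Nat using (ℕ; zero; suc; _+_; _<_)
open import Data.Nat.Properties using (+-suc; m≤m+n; n<1+n; <-irrefl)
open import Data.Product using (Σ; ∃; _×_; _,_; proj₁)
open import Data.Sum using (_⊎_; inj₁; inj₂)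
open import Relation.Binary.PropositionalEquality using (_≡_; _≢_; refl; sym; trans; cong; subst)
open import Relation.Nullary using (¬_)

atom : ℕ → ℕ → GFact
atom p t = gfact p [] t

IsAtom : ℕ → GFact → Set
IsAtom p f = ∃ λ t → f ≡ atom p t

HasAtom : ℕ → Config → Set
HasAtom p S = ∃ λ t → atom p t ∈ facts S

atomPat : ℕ → PFact
atomPat p = pfact p [] 1

-- Time variable 0 is the global time T, time variable 1 the timestamp of
-- the matched fact.
timing : ℕ → ℕ → ℕ → ℕ
timing t s zero    = t
timing t s (suc _) = s

turnInto : ℕ → ℕ → Rule
turnInto p q = rule 0 [] (atomPat p ∷ []) [] [] (qfact q [] 0 ∷ [])

discard : ℕ → Rule
discard p = rule 0 [] (atomPat p ∷ []) [] [] []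

loop : ℕ → Rule
loop p = rule 0 (atomPat p ∷ []) [] [] [] []

presence : ℕ → CritSpec
presence q = critPat 0 (atomPat q ∷ []) [] ∷ []

precondition : Rule → List PFact
precondition r = kept r ++ consumed r

matched⇒∈ : ∀ {A B : Set} {f : A → B} {x xs ys rest} →
            x ∈ xs → ys ↭ map f xs ++ rest → f x ∈ ys
matched⇒∈ {f = f} x∈xs ys↭ = ∈-resp-↭ (↭-sym ys↭) (∈-++⁺ˡ (∈-map⁺ f x∈xs))

↭-pull : ∀ {A : Set} {x : A} {xs} → x ∈ xs → ∃ λ rest → xs ↭ x ∷ rest
↭-pull x∈xs with ys , zs , refl ← ∈-∃++ x∈xs = ys ++ zs , shift _ ys zs

¬step-without : ∀ {p} r {S S′} → p ∈ map ppred (precondition r) →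
                All (λ f → pred f ≢ p) (facts S) → ¬ InstStep r S S′
¬step-without _ needs absent (σ , τ , _ , _ , _ , _ , _ , match , _)
  with pf , pf∈ , refl ← ∈-map⁻ ppred needs =
  All.lookup absent (matched⇒∈ pf∈ match) refl

¬critical-without : ∀ {q S} → All (λ f → pred f ≢ q) (facts S) → ¬ Critical (presence q) S
¬critical-without {q} absent (here (σ , τ , _ , _ , _ , match)) =
  All.lookup absent (matched⇒∈ {f = instP σ τ} {xs = atomPat q ∷ []} (here refl) match) refl

critical-of-atom : ∀ {q t S} → atom q t ∈ facts S → Critical (presence q) S
critical-of-atom {t = t} {S} a∈ with rest , match ← ↭-pull a∈ =
  here ((λ _ → cst 0) , timing (now S) t , rest , refl , [] , match)

turnInto-step : ∀ {p q s t fs} →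
  InstStep (turnInto p q) (config t (atom p s ∷ fs)) (config t (atom q (t + 0) ∷ fs))
turnInto-step {s = s} {t} =
  (λ _ → cst 0) , timing t s , _ , refl , [] , [] , AllPairs.[] , ↭-refl , refl , ↭-refl

discard-step : ∀ {p s t fs} → InstStep (discard p) (config t (atom p s ∷ fs)) (config t fs)
discard-step {s = s} {t} =
  (λ _ → cst 0) , timing t s , _ , refl , [] , [] , AllPairs.[] , ↭-refl , refl , ↭-refl

loop-applicable : ∀ {p R S} → loop p ∈ R → HasAtom p S → Applicable R S
loop-applicable {S = S} loop∈ (s , a∈) with rest , match ← ↭-pull a∈ =
  lose loop∈ (config (now S) (atom _ s ∷ rest) ,
    (λ _ → cst 0) , timing (now S) s , rest , refl , [] , [] , AllPairs.[] ,
    match , refl , ↭-refl)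

drain : ℕ → List GFact → Trace
drain t fs       zero    = config t fs
drain t []       (suc i) = drain (suc t) [] i
drain t (_ ∷ fs) (suc i) = drain t fs i

drain-All : ∀ {P : GFact → Set} t {fs} → All P fs → ∀ i → All P (facts (drain t fs i))
drain-All t         Pfs        zero    = Pfs
drain-All t {[]}    Pfs        (suc i) = drain-All (suc t) [] i
drain-All t {_ ∷ _} (_ ∷ Pfs) (suc i) = drain-All t Pfs i

now-drain-[] : ∀ t i → now (drain t [] i) ≡ i + t
now-drain-[] t zero    = refl
now-drain-[] t (suc i) = trans (now-drain-[] (suc t) i) (+-suc i t)

drain-diverges : ∀ t fs n → ∃ λ i → n < now (drain t fs i)
drain-diverges t []       n = suc n , subst (n <_) (sym (now-drain-[] t (suc n))) (m≤m+n (suc n) t)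
drain-diverges t (_ ∷ fs) n with i , n< ← drain-diverges t fs n = suc i , n<

module _ {R p} (discard∈ : discard p ∈ R) (idle : ∀ t → ¬ Applicable R (config t [])) where

  drain-steps : ∀ t {fs} → All (IsAtom p) fs → ∀ i → LStep R (drain t fs i) (drain t fs (suc i))
  drain-steps t {[]}    _                 zero    = inj₂ ((refl , refl) , idle t)
  drain-steps t {_ ∷ _} ((_ , refl) ∷ _) zero    = inj₁ (lose discard∈ discard-step)
  drain-steps t {[]}    _                 (suc i) = drain-steps (suc t) [] i
  drain-steps t {_ ∷ _} (_ ∷ atoms)       (suc i) = drain-steps t atoms i

  drain-infTime : ∀ {S} → All (IsAtom p) (facts S) → InfTimeLTS R S (drain (now S) (facts S))
  drain-infTime {S} atoms = refl , drain-steps (now S) atoms , drain-diverges (now S) (facts S)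

Spares : ℕ → Rule → Set
Spares p r = All (λ pf → ppred pf ≢ p) (consumed r)

instStep-freezes : ∀ {p r} {S S′ : Config} → Spares p r → InstStep r S S′ →
                   HasAtom p S → now S′ ≡ now S × HasAtom p S′
instStep-freezes {r = r} {S} {S′} spares (σ , τ , rest , _ , _ , _ , _ , match , now≡ , result) (t , a∈) =
  now≡ , t , kept-atom (∈-++⁻ (map (instP σ τ) (precondition r)) (∈-resp-↭ match a∈))
  where
  into-result : ∀ {f} → f ∈ map (instP σ τ) (kept r) ++ map (instQ σ (now S)) (produced r) ++ rest →
                f ∈ facts S′
  into-result = ∈-resp-↭ (↭-sym result)
  kept-atom : atom _ t ∈ map (instP σ τ) (precondition r) ⊎ atom _ t ∈ rest → atom _ t ∈ facts S′
  kept-atom (inj₂ a∈rest) =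
    into-result (∈-++⁺ʳ (map (instP σ τ) (kept r)) (∈-++⁺ʳ (map (instQ σ (now S)) (produced r)) a∈rest))
  kept-atom (inj₁ a∈pre) with pf , pf∈ , a≡ ← ∈-map⁻ (instP σ τ) a∈pre with ∈-++⁻ (kept r) pf∈
  ... | inj₁ pf∈kept     =
    subst (_∈ facts S′) (sym a≡) (into-result (∈-++⁺ˡ (∈-map⁺ (instP σ τ) pf∈kept)))
  ... | inj₂ pf∈consumed = ⊥-elim (All.lookup spares pf∈consumed (sym (cong pred a≡)))

module _ {R p} (loop∈ : loop p ∈ R) (spares : All (Spares p) R) where

  lstep-freezes : ∀ {S S′} → LStep R S S′ → HasAtom p S → now S′ ≡ now S × HasAtom p S′
  lstep-freezes {S} {S′} (inj₁ inst) has =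
    All.lookupWith (λ sp st → instStep-freezes {S = S} {S′} sp st has) spares inst
  lstep-freezes (inj₂ (_ , ¬applicable)) has = ⊥-elim (¬applicable (loop-applicable loop∈ has))

  time-frozen : ∀ {tr : Trace} → (∀ i → LStep R (tr i) (tr (suc i))) → HasAtom p (tr 0) →
                ∀ (i : ℕ) → now (tr i) ≡ now (tr 0) × HasAtom p (tr i)
  time-frozen steps has zero = refl , has
  time-frozen {tr} steps has (suc i) with now≡ , has′ ← time-frozen {tr} steps has i =
    let n≡ , has″ = lstep-freezes {tr i} {tr (suc i)} (steps i) has′ in trans n≡ now≡ , has″

  ¬infTime : ∀ {S tr} → HasAtom p S → ¬ InfTimeLTS R S tr
  ¬infTime {tr = tr} has (refl , steps , diverges) with i , later ← diverges (now (tr 0)) =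
    <-irrefl (sym (proj₁ (time-frozen {tr} steps has i))) later

A B : ℕ
A = 0
B = 1

S₀ S₁ : Config
S₀ = config 0 (atom A 0 ∷ [])
S₁ = config 0 (atom B 0 ∷ [])

A→B : InstStep (turnInto A B) S₀ S₁
A→B = turnInto-step

¬critical-[] : ∀ {S} → ¬ Critical [] S
¬critical-[] ()

loopingSystem : System
loopingSystem = turnInto A B ∷ discard A ∷ loop B ∷ []

looping-idle : ∀ t → ¬ Applicable loopingSystem (config t [])
looping-idle t = All¬⇒¬Any
  ( (λ (_ , st) → ¬step-without (turnInto A B) (here refl) [] st)
  ∷ (λ (_ , st) → ¬step-without (discard A) (here refl) [] st)
  ∷ (λ (_ , st) → ¬step-without (loop B) (here refl) [] st)
  ∷ [])

looping-S : SProp loopingSystem S₀ []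
looping-S =
  (drain 0 (atom A 0 ∷ []) , drain-infTime (there (here refl)) looping-idle ((0 , refl) ∷ []) , λ _ → ¬critical-[]) ,
  λ _ _ _ → ¬critical-[]

looping-¬L : ¬ LProp loopingSystem S₀ []
looping-¬L (_ , fromReachable)
  with _ , infTime , _ ← fromReachable S₁ (step (start ¬critical-[]) (inj₁ (here A→B)) ¬critical-[]) =
  ¬infTime (there (there (here refl))) spares (0 , here refl) infTime
  where
  spares : All (Spares B) loopingSystem
  spares = ((λ ()) ∷ []) ∷ ((λ ()) ∷ []) ∷ [] ∷ []

branchingSystem : System
branchingSystem = turnInto A B ∷ discard A ∷ []

branching-idle : ∀ {S} → All (λ f → pred f ≢ A) (facts S) → ¬ Applicable branchingSystem S
branching-idle noA = All¬⇒¬Any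
  ( (λ (_ , st) → ¬step-without (turnInto A B) (here refl) noA st)
  ∷ (λ (_ , st) → ¬step-without (discard A) (here refl) noA st)
  ∷ [])

atom-A≢B : ∀ {f} → IsAtom A f → pred f ≢ B
atom-A≢B (_ , refl) ()

branching-Z : ∀ {S} → All (IsAtom A) (facts S) → ZProp branchingSystem S (presence B)
branching-Z {S} atoms =
  drain (now S) (facts S) ,
  drain-infTime (there (here refl)) (λ _ → branching-idle []) atoms ,
  λ i → ¬critical-without (All.map atom-A≢B (drain-All (now S) atoms i))

reachable-atoms : ∀ {S} → CReach branchingSystem (presence B) S₀ S → All (IsAtom A) (facts S)
reachable-atoms (start _) = (0 , refl) ∷ []
reachable-atoms (step _ (inj₁ (here (_ , _ , _ , _ , _ , _ , _ , _ , _ , result))) ¬critical) =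
  ⊥-elim (¬critical (critical-of-atom (∈-resp-↭ (↭-sym result) (here refl))))
reachable-atoms (step reach (inj₁ (there (here (_ , _ , _ , _ , _ , _ , _ , match , _ , result)))) _)
  with _ ∷ atoms ← All-resp-↭ match (reachable-atoms reach) = All-resp-↭ (↭-sym result) atoms
reachable-atoms (step reach (inj₂ ((_ , facts≡) , _)) _) =
  subst (All (IsAtom A)) (sym facts≡) (reachable-atoms reach)

branching-L : LProp branchingSystem S₀ (presence B)
branching-L = branching-Z ((0 , refl) ∷ []) , λ _ reach → branching-Z (reachable-atoms reach)

critical-run : Trace
critical-run zero    = S₀
critical-run (suc t) = config t (atom B 0 ∷ [])

critical-run-infTime : InfTimeLTS branchingSystem S₀ critical-run
critical-run-infTime = refl , steps , λ n → suc (suc n) , n<1+n n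
  where
  steps : ∀ i → LStep branchingSystem (critical-run i) (critical-run (suc i))
  steps zero    = inj₁ (here A→B)
  steps (suc i) = inj₂ ((refl , refl) , branching-idle ((λ ()) ∷ []))

branching-¬S : ¬ SProp branchingSystem S₀ (presence B)
branching-¬S (_ , allCompliant) =
  allCompliant critical-run critical-run-infTime 1 (critical-of-atom (here refl))

proposition10 :
    (Σ System λ R → Σ Config λ S0 → Σ CritSpec λ CS →
       WFInstance R CS × SProp R S0 CS × ¬ LProp R S0 CS)
    × (Σ System λ R → Σ Config λ S0 → Σ CritSpec λ CS →
       WFInstance R CS × LProp R S0 CS × ¬ SProp R S0 CS)
proposition10 =
  (loopingSystem , S₀ , [] , ((wf-turnInto ∷ wf-discard ∷ wf-loop ∷ []) , []) , looping-S , looping-¬L) ,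
  (branchingSystem , S₀ , presence B , ((wf-turnInto ∷ wf-discard ∷ []) , [] ∷ []) , branching-L , branching-¬S)
  where
  wf-turnInto : WFRule (turnInto A B)
  wf-turnInto = [] , [] , AllPairs.[] , [] ∷ []
  wf-discard : WFRule (discard A)
  wf-discard = [] , [] , AllPairs.[] , []
  wf-loop : WFRule (loop B)
  wf-loop = [] , [] , AllPairs.[] , []
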